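{- For every $n\ge 2$, $$D_t(G_n,x)=(x+1)\big[D_t(T_n,x)-D_t(G_{n-1},x)\big]+x^2D_t(G_{n-2},x),$$ where $D_t(G_0,x)=x^2$, $D_t(G_1,x)=x^4+3x^3+3x^2$ and $D_t(T_2,x)=x^5+5x^4+6x^3+4x^2$.
   Context: All graphs are finite and simple. A set $D$ of vertices of a graph $G$ is a total dominating set if every vertex of $G$ is adjacent to some vertex of $D$; $d_t(G,i)$ is the number of total dominating sets of size $i$, and $D_t(G,x)=\sum_{i\ge1}d_t(G,i)x^i$. The chain triangular cactus $T_n$ ($n\ge1$) consists of triangles $t_1,\dots,t_n$ such that $t_i$ and $t_{i+1}$ share exactly one vertex, non-consecutive triangles are vertex-disjoint, and for $2\le i\le n-1$ the vertex shared by $t_i$ with $t_{i-1}$ differs from the vertex shared by $t_i$ with $t_{i+1}$ (all such graphs of length $n$ are isomorphic); $T_0$ is a single vertex. For $n\ge1$, $G_n$ is obtained from $T_n$ by adding a new vertex $u$ joined by an edge to a vertex of the end triangle $t_n$ that is not shared with $t_{n-1}$ (any vertex of $t_1$ when $n=1$); $G_0$ is $T_0$ with a pendant vertex attached, i.e. $G_0=K_2$. -}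

module Defs where

open import Data.Bool using (Bool; true; false; _∧_; _∨_; not; if_then_else_)
open import Data.Nat using (ℕ; zero; suc; _+_; _*_; _∸_; _≡ᵇ_; _<ᵇ_)
open import Data.Integer as ℤ using (ℤ; +_)
open import Data.Fin using (Fin; toℕ)
open import Data.Fin.Subset using (Subset; inside; outside; _∈_; ∣_∣)
open import Data.Fin.Subset.Properties using (_∈?_)
open import Data.Fin.Properties using (any?; all?)
open import Data.List using (List; []; _∷_; _++_; map; filter; length)
open import Data.Vec using ([]; _∷_)
open import Data.Product using (∃; _×_; _,_)
open import Data.Product.Properties using ()
open import Relation.Nullary using (Dec)
open import Relation.Nullary.Decidable using (_×-dec_)
open import Relation.Binary.PropositionalEquality using (_≡_)
import Data.Bool.Properties as BoolP
import Data.Nat.Properties as ℕP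

record Graph : Set where
  field
    order : ℕ
    adj   : Fin order → Fin order → Bool

open Graph public

TotalDominating : (G : Graph) → Subset (order G) → Set
TotalDominating G D = ∀ v → ∃ λ w → (w ∈ D) × (adj G v w ≡ true)

totalDominating? : (G : Graph) (D : Subset (order G)) → Dec (TotalDominating G D)
totalDominating? G D =
  all? (λ v → any? (λ w → (w ∈? D) ×-dec (adj G v w BoolP.≟ true)))

allSubsets : (m : ℕ) → List (Subset m)
allSubsets zero    = [] ∷ []
allSubsets (suc m) = map (inside ∷_) (allSubsets m) ++ map (outside ∷_) (allSubsets m)

dt : Graph → ℕ → ℕ
dt G i = length (filter (λ D → (∣ D ∣ ℕP.≟ i) ×-dec totalDominating? G D)
                       (allSubsets (order G)))

Poly : Set
Poly = ℕ → ℤ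

_≈ₚ_ : Poly → Poly → Set
p ≈ₚ q = ∀ i → p i ≡ q i

infix 4 _≈ₚ_
infixl 6 _+ₚ_ _-ₚ_

_+ₚ_ : Poly → Poly → Poly
(p +ₚ q) i = p i ℤ.+ q i

_-ₚ_ : Poly → Poly → Poly
(p -ₚ q) i = p i ℤ.- q i

X* : Poly → Poly
X* p zero    = + 0
X* p (suc i) = p i

[X+1]* : Poly → Poly
[X+1]* p = X* p +ₚ p

X²* : Poly → Poly
X²* p = X* (X* p)

fromList : List ℤ → Poly
fromList []       i       = + 0
fromList (a ∷ as) zero    = a
fromList (a ∷ as) (suc i) = fromList as i

Dt : Graph → Poly
Dt G zero    = + 0
Dt G (suc i) = + dt G (suc i)

-- Chain triangular cactus T_n on vertices 0..2n:
-- triangle t_{k+1} (k < n) has vertices 2k, 2k+1, 2k+2;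
-- t_{k+1} and t_{k+2} share exactly vertex 2k+2.

inTri : ℕ → ℕ → Bool
inTri k a = (a ≡ᵇ 2 * k) ∨ (a ≡ᵇ 2 * k + 1) ∨ (a ≡ᵇ 2 * k + 2)

anyBelow : ℕ → (ℕ → Bool) → Bool
anyBelow zero    P = false
anyBelow (suc n) P = P n ∨ anyBelow n P

adjTℕ : ℕ → ℕ → ℕ → Bool
adjTℕ n a b = not (a ≡ᵇ b) ∧ anyBelow n (λ k → inTri k a ∧ inTri k b)

T : ℕ → Graph
T n = record { order = suc (2 * n) ; adj = λ a b → adjTℕ n (toℕ a) (toℕ b) }

-- G_n: T_n plus a new vertex u = 2n+1 joined to vertex 2n-1 of t_n
-- (not shared with t_{n-1}); for n = 0 (truncated 2n∸1 = 0) this is K_2.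
adjGℕ : ℕ → ℕ → ℕ → Bool
adjGℕ n a b = adjTℕ n a b
            ∨ ((a ≡ᵇ suc (2 * n)) ∧ (b ≡ᵇ 2 * n ∸ 1))
            ∨ ((b ≡ᵇ suc (2 * n)) ∧ (a ≡ᵇ 2 * n ∸ 1))

Gr : ℕ → Graph
Gr n = record { order = suc (suc (2 * n)) ; adj = λ a b → adjGℕ n (toℕ a) (toℕ b) }

-- Vertices of T_n are 0..2n, triangle t_(k+1) being {2k, 2k+1, 2k+2}; G_n adds the
-- pendant vertex 2n+1 at 2n-1.  Read from the front, both graphs begin with a
-- triangle {0,1,2} whose vertices 0,1 have no other neighbours, and deleting 0,1
-- leaves T_(n-1) (resp. G_(n-1), when n ≥ 2) shifted by two.  We count dominating sets by their
-- behaviour on the first vertex: the "state" of a graph is the 2×2 family of size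
-- polynomials indexed by (vertex 0 dominated from outside?, vertex 0 chosen?).
-- Deleting a front triangle acts on states by one fixed linear map `transfer`
-- (front-domination / state-transfer), and D_t is a linear functional `total` of the
-- state.  Since the combination  (x+1)(t − b) + x²c  is preserved by every linear map
-- built from multiplication by x, addition and zeroing, the recurrence, once checked
-- on the states of G_3, T_3, G_2, G_1 by evaluation, propagates to all n ≥ 3; the case
-- n = 2 and the three initial values are checked by evaluation as well.
module Submission where

open import Defs
open import Data.Nat using (ℕ; _≤_; _∸_)
open import Data.Integer using (+_)
open import Data.List using (_∷_; [])
open import Data.Product using (_×_)

open import Data.Bool using (Bool; true; false; _∧_; _∨_; not)
open import Data.Bool.Properties using (∧-zeroʳ; ∧-identityʳ; ∨-identityʳ; ∨-zeroʳ; ∧-assoc; T-≡)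
open import Data.Nat using (zero; suc; _+_; _*_; _≡ᵇ_; s≤s)
import Data.Nat.Properties as ℕP
open import Data.Integer as ℤ using (ℤ; _-_)
open import Data.Integer.Tactic.RingSolver using (solve-∀)
open import Data.Fin using (Fin; toℕ) renaming (zero to fzero; suc to fsuc)
open import Data.Fin.Subset using (Subset; _∈_; ∣_∣)
open import Data.Fin.Properties using (all?)
open import Data.Vec using (Vec; []; _∷_; replicate; here; there)
open import Data.List using (map; filter; length)
open import Data.List.Properties using (length-++; filter-++)
open import Data.Product using (∃; _,_)
open import Function using (_∘_; Equivalence)
open import Level using (0ℓ)
open import Relation.Nullary using (Dec; does; proof)
open import Relation.Nullary.Decidable using (True; toWitness)
open import Relation.Nullary.Reflects using (det; fromEquivalence)
open import Relation.Unary using (Pred; Decidable)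
open import Relation.Binary.PropositionalEquality

0ₚ : Poly
0ₚ _ = + 0

1ₚ : Poly
1ₚ zero    = + 1
1ₚ (suc _) = + 0

when : Bool → Poly → Poly
when true  p = p
when false p = 0ₚ

weigh : (Bool → Poly) → Poly
weigh g = X* (g true) +ₚ g false

≈ₚ-sym : ∀ {p q} → p ≈ₚ q → q ≈ₚ p
≈ₚ-sym h i = sym (h i)

≈ₚ-trans : ∀ {p q r} → p ≈ₚ q → q ≈ₚ r → p ≈ₚ r
≈ₚ-trans h k i = trans (h i) (k i)

X*-cong : ∀ {p q} → p ≈ₚ q → X* p ≈ₚ X* q
X*-cong h zero    = refl
X*-cong h (suc i) = h i

+ₚ-cong : ∀ {p q r s} → p ≈ₚ q → r ≈ₚ s → p +ₚ r ≈ₚ q +ₚ s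
+ₚ-cong h k i = cong₂ ℤ._+_ (h i) (k i)

weigh-cong : ∀ {g h : Bool → Poly} → (∀ d → g d ≈ₚ h d) → weigh g ≈ₚ weigh h
weigh-cong e = +ₚ-cong (X*-cong (e true)) (e false)

rhs : Poly → Poly → Poly → Poly
rhs t b c = [X+1]* (t -ₚ b) +ₚ X²* c

rhs-cong : ∀ {t t′ b b′ c c′} → t ≈ₚ t′ → b ≈ₚ b′ → c ≈ₚ c′ → rhs t b c ≈ₚ rhs t′ b′ c′
rhs-cong {t} {t′} {b} {b′} ht hb hc = +ₚ-cong (+ₚ-cong (X*-cong t-b) t-b) (X*-cong (X*-cong hc))
  where
  t-b : t -ₚ b ≈ₚ t′ -ₚ b′
  t-b j = cong₂ _-_ (ht j) (hb j)

rhs-X* : ∀ t b c → X* (rhs t b c) ≈ₚ rhs (X* t) (X* b) (X* c)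
rhs-X* t b c zero    = refl
rhs-X* t b c (suc i) = cong (λ z → (z ℤ.+ (t i - b i)) ℤ.+ X²* c i) (X*-sub i)
  where
  X*-sub : X* (t -ₚ b) ≈ₚ X* t -ₚ X* b
  X*-sub zero    = refl
  X*-sub (suc j) = refl

-- The ring identity behind the additivity of `rhs`, one coefficient at a time.
interchange : ∀ a b c d e f g h p q →
  (((a - b) ℤ.+ (c - d)) ℤ.+ p) ℤ.+ (((e - f) ℤ.+ (g - h)) ℤ.+ q)
    ≡ (((a ℤ.+ e) - (b ℤ.+ f)) ℤ.+ ((c ℤ.+ g) - (d ℤ.+ h))) ℤ.+ (p ℤ.+ q)
interchange = solve-∀

-- Coefficient i of `rhs t b c` only involves t, b at i−1, i and c at i−2.
rhs-+ₚ : ∀ t₁ b₁ c₁ t₂ b₂ c₂ →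
  rhs t₁ b₁ c₁ +ₚ rhs t₂ b₂ c₂ ≈ₚ rhs (t₁ +ₚ t₂) (b₁ +ₚ b₂) (c₁ +ₚ c₂)
rhs-+ₚ t₁ b₁ c₁ t₂ b₂ c₂ zero =
  interchange (+ 0) (+ 0) (t₁ 0) (b₁ 0) (+ 0) (+ 0) (t₂ 0) (b₂ 0) (+ 0) (+ 0)
rhs-+ₚ t₁ b₁ c₁ t₂ b₂ c₂ (suc zero) =
  interchange (t₁ 0) (b₁ 0) (t₁ 1) (b₁ 1) (t₂ 0) (b₂ 0) (t₂ 1) (b₂ 1) (+ 0) (+ 0)
rhs-+ₚ t₁ b₁ c₁ t₂ b₂ c₂ (suc (suc j)) =
  interchange (t₁ (suc j)) (b₁ (suc j)) (t₁ (suc (suc j))) (b₁ (suc (suc j)))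
              (t₂ (suc j)) (b₂ (suc j)) (t₂ (suc (suc j))) (b₂ (suc (suc j))) (c₁ j) (c₂ j)

rhs-0ₚ : 0ₚ ≈ₚ rhs 0ₚ 0ₚ 0ₚ
rhs-0ₚ zero          = refl
rhs-0ₚ (suc zero)    = refl
rhs-0ₚ (suc (suc j)) = refl

-- `Combination p t b c` says p = (x+1)(t − b) + x²c.  It is a record so that
-- t, b, c can be inferred from it.
record Combination (p t b c : Poly) : Set where
  constructor combination
  field holds : p ≈ₚ rhs t b c
open Combination public

combination-resp : ∀ {p t b c p′ t′ b′ c′} →
  p′ ≈ₚ p → t ≈ₚ t′ → b ≈ₚ b′ → c ≈ₚ c′ → Combination p t b c → Combination p′ t′ b′ c′
combination-resp hp ht hb hc (combination h) =
  combination (≈ₚ-trans hp (≈ₚ-trans h (rhs-cong ht hb hc)))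

combination-X* : ∀ {p t b c} → Combination p t b c → Combination (X* p) (X* t) (X* b) (X* c)
combination-X* {t = t} {b} {c} (combination h) = combination (≈ₚ-trans (X*-cong h) (rhs-X* t b c))

combination-+ₚ : ∀ {p t b c p′ t′ b′ c′} → Combination p t b c → Combination p′ t′ b′ c′ →
  Combination (p +ₚ p′) (t +ₚ t′) (b +ₚ b′) (c +ₚ c′)
combination-+ₚ {t = t} {b} {c} {t′ = t′} {b′} {c′} (combination h) (combination h′) =
  combination (≈ₚ-trans (+ₚ-cong h h′) (rhs-+ₚ t b c t′ b′ c′))

combination-when : ∀ x {p t b c} → Combination p t b c →
  Combination (when x p) (when x t) (when x b) (when x c)
combination-when true  h = h
combination-when false h = combination rhs-0ₚ

combination-weigh : ∀ {p t b c : Bool → Poly} → (∀ d → Combination (p d) (t d) (b d) (c d)) →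
  Combination (weigh p) (weigh t) (weigh b) (weigh c)
combination-weigh h = combination-+ₚ (combination-X* (h true)) (h false)

sizePoly : (m : ℕ) → (Vec Bool m → Bool) → Poly
sizePoly zero    P = when (P []) 1ₚ
sizePoly (suc m) P = weigh (λ d → sizePoly m (λ D → P (d ∷ D)))

sizePoly-cong : ∀ m {P Q : Vec Bool m → Bool} → (∀ D → P D ≡ Q D) → sizePoly m P ≈ₚ sizePoly m Q
sizePoly-cong zero    h rewrite h [] = λ _ → refl
sizePoly-cong (suc m) h = weigh-cong (λ d → sizePoly-cong m (λ D → h (d ∷ D)))

sizePoly-never : ∀ m → sizePoly m (λ _ → false) ≈ₚ 0ₚ
sizePoly-never zero    i = refl
sizePoly-never (suc m) = ≈ₚ-trans (weigh-cong (λ _ → sizePoly-never m)) zero-sum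
  where
  zero-sum : weigh (λ _ → 0ₚ) ≈ₚ 0ₚ
  zero-sum zero    = refl
  zero-sum (suc i) = refl

sizePoly-when : ∀ m b (Q : Vec Bool m → Bool) → sizePoly m (λ D → b ∧ Q D) ≈ₚ when b (sizePoly m Q)
sizePoly-when m true  Q i = refl
sizePoly-when m false Q   = sizePoly-never m

sizePoly-empty : ∀ m P → P (replicate m false) ≡ false → sizePoly m P 0 ≡ + 0
sizePoly-empty zero    P h rewrite h = refl
sizePoly-empty (suc m) P h = cong (ℤ._+_ (+ 0)) (sizePoly-empty m (λ D → P (false ∷ D)) h)

length-filter-map : ∀ {A B : Set} {P : Pred B 0ℓ} (P? : Decidable P) (f : A → B) xs →
  length (filter P? (map f xs)) ≡ length (filter (P? ∘ f) xs)
length-filter-map P? f []       = refl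
length-filter-map P? f (x ∷ xs) with does (P? (f x))
... | true  = cong suc (length-filter-map P? f xs)
... | false = length-filter-map P? f xs

count-sizePoly : ∀ m {P : Pred (Subset m) 0ℓ} (P? : Decidable P) (q : Subset m → Bool) i →
  (∀ D → does (P? D) ≡ ((∣ D ∣ ≡ᵇ i) ∧ q D)) →
  + length (filter P? (allSubsets m)) ≡ sizePoly m q i
count-sizePoly zero P? q i h with q [] | does (P? []) | h []
count-sizePoly zero P? q zero    h | true  | _ | refl = refl
count-sizePoly zero P? q zero    h | false | _ | refl = refl
count-sizePoly zero P? q (suc i) h | true  | _ | refl = refl
count-sizePoly zero P? q (suc i) h | false | _ | refl = refl
count-sizePoly (suc m) P? q i h
  rewrite filter-++ P? (map (true ∷_) (allSubsets m)) (map (false ∷_) (allSubsets m))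
        | length-++ (filter P? (map (true ∷_) (allSubsets m))) {filter P? (map (false ∷_) (allSubsets m))}
        | length-filter-map P? (true ∷_) (allSubsets m)
        | length-filter-map P? (false ∷_) (allSubsets m)
  = cong₂ ℤ._+_ (withFirst i h) (count-sizePoly m (P? ∘ (false ∷_)) _ i (h ∘ (false ∷_)))
  where
  withFirst : ∀ i → (∀ D → does (P? D) ≡ ((∣ D ∣ ≡ᵇ i) ∧ q D)) →
    + length (filter (P? ∘ (true ∷_)) (allSubsets m)) ≡ X* (sizePoly m (λ D → q (true ∷ D))) i
  withFirst zero h = trans
    (count-sizePoly m (P? ∘ (true ∷_)) (λ _ → false) 0 (λ D → trans (h (true ∷ D)) (sym (∧-zeroʳ _))))
    (sizePoly-never m 0)
  withFirst (suc i) h = count-sizePoly m (P? ∘ (true ∷_)) _ i (h ∘ (true ∷_))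

-- Total domination is decided by boolean functions on ℕ-indexed adjacencies, which
-- compute by evaluation and interact well with shifting vertices by two.

every : ℕ → (ℕ → Bool) → Bool
every zero    f = true
every (suc m) f = f 0 ∧ every m (λ v → f (suc v))

someIn : ∀ {m} → Vec Bool m → (ℕ → Bool) → Bool
someIn []      f = false
someIn (b ∷ D) f = (b ∧ f 0) ∨ someIn D (λ w → f (suc w))

-- D dominates every vertex of {0..m-1} in the adjacency A, where vertex 0 also
-- counts as dominated when `ext` holds (it has a chosen neighbour outside).
dominatesᵇ : (m : ℕ) → (ℕ → ℕ → Bool) → (ext : Bool) → Vec Bool m → Bool
dominatesᵇ m A ext D = every m (λ v → (ext ∧ (v ≡ᵇ 0)) ∨ someIn D (A v))

every-cong : ∀ m {f g : ℕ → Bool} → (∀ v → f v ≡ g v) → every m f ≡ every m g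
every-cong zero    h = refl
every-cong (suc m) h = cong₂ _∧_ (h 0) (every-cong m (λ v → h (suc v)))

someIn-cong : ∀ {m} (D : Vec Bool m) {f g : ℕ → Bool} → (∀ v → f v ≡ g v) → someIn D f ≡ someIn D g
someIn-cong []      h = refl
someIn-cong (b ∷ D) h = cong₂ (λ x y → (b ∧ x) ∨ y) (h 0) (someIn-cong D (λ v → h (suc v)))

someIn-never : ∀ {m} (D : Vec Bool m) → someIn D (λ _ → false) ≡ false
someIn-never []          = refl
someIn-never (true  ∷ D) = someIn-never D
someIn-never (false ∷ D) = someIn-never D

someIn-empty : ∀ m f → someIn (replicate m false) f ≡ false
someIn-empty zero    f = refl
someIn-empty (suc m) f = someIn-empty m (λ w → f (suc w))

every-sound : ∀ m f → every m f ≡ true → ∀ (v : Fin m) → f (toℕ v) ≡ true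
every-sound (suc m) f h v with f 0 in f0 | v
... | true | fzero  = f0
... | true | fsuc v = every-sound m (λ w → f (suc w)) h v

every-complete : ∀ m f → (∀ (v : Fin m) → f (toℕ v) ≡ true) → every m f ≡ true
every-complete zero    f h = refl
every-complete (suc m) f h rewrite h fzero = every-complete m (λ v → f (suc v)) (h ∘ fsuc)

someIn-sound : ∀ {m} (D : Vec Bool m) f → someIn D f ≡ true → ∃ λ w → w ∈ D × f (toℕ w) ≡ true
someIn-sound (true ∷ D) f h with f 0 in f0
... | true  = fzero , here , f0
... | false with someIn-sound D (λ w → f (suc w)) h
...   | w , w∈D , fw = fsuc w , there w∈D , fw
someIn-sound (false ∷ D) f h with someIn-sound D (λ w → f (suc w)) h
... | w , w∈D , fw = fsuc w , there w∈D , fw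

someIn-complete : ∀ {m} (D : Vec Bool m) f w → w ∈ D → f (toℕ w) ≡ true → someIn D f ≡ true
someIn-complete (_ ∷ D) f fzero    here      fw rewrite fw = refl
someIn-complete (b ∷ D) f (fsuc w) (there p) fw
  rewrite someIn-complete D (λ v → f (suc v)) w p fw = ∨-zeroʳ (b ∧ f 0)

does-reflects : ∀ {P : Set} (P? : Dec P) {b} → (P → b ≡ true) → (b ≡ true → P) → does P? ≡ b
does-reflects P? to from =
  det (proof P?) (fromEquivalence (from ∘ Equivalence.to T-≡) (Equivalence.from T-≡ ∘ to))

graphOn : ℕ → (ℕ → ℕ → Bool) → Graph
graphOn k A = record { order = suc k ; adj = λ v w → A (toℕ v) (toℕ w) }

dominatesᵇ-correct : ∀ k A D →
  (TotalDominating (graphOn k A) D → dominatesᵇ (suc k) A false D ≡ true) ×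
  (dominatesᵇ (suc k) A false D ≡ true → TotalDominating (graphOn k A) D)
dominatesᵇ-correct k A D = sound , complete
  where
  sound : TotalDominating (graphOn k A) D → dominatesᵇ (suc k) A false D ≡ true
  sound td = every-complete (suc k) (λ v → someIn D (A v)) λ v →
    let (w , w∈D , vw) = td v in someIn-complete D (A (toℕ v)) w w∈D vw
  complete : dominatesᵇ (suc k) A false D ≡ true → TotalDominating (graphOn k A) D
  complete h v = someIn-sound D (A (toℕ v)) (every-sound (suc k) (λ u → someIn D (A u)) h v)

empty-not-dominating : ∀ k A → dominatesᵇ (suc k) A false (replicate (suc k) false) ≡ false
empty-not-dominating k A rewrite someIn-empty (suc k) (A 0) = refl

Dt-graphOn : ∀ k A → Dt (graphOn k A) ≈ₚ sizePoly (suc k) (dominatesᵇ (suc k) A false)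
Dt-graphOn k A zero =
  sym (sizePoly-empty (suc k) (dominatesᵇ (suc k) A false) (empty-not-dominating k A))
Dt-graphOn k A (suc i) = count-sizePoly (suc k) _ _ (suc i) λ D →
  let (sound , complete) = dominatesᵇ-correct k A D in
  cong ((∣ D ∣ ≡ᵇ suc i) ∧_) (does-reflects (totalDominating? (graphOn k A) D) sound complete)

-- A state assigns a polynomial to each (vertex 0 dominated from outside?, vertex 0 chosen?).
State : Set
State = Bool → Bool → Poly

_≈ₛ_ : State → State → Set
v ≈ₛ w = ∀ e d → v e d ≈ₚ w e d

-- The state of the adjacency A on vertices 0..k: the size polynomial of the sets
-- D ⊆ {1..k} such that (d ∷ D) dominates, vertex 0 being helped from outside if e.
state : (ℕ → ℕ → Bool) → ℕ → State
state A k e d = sizePoly k (λ D → dominatesᵇ (suc k) A e (d ∷ D))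

-- D_t is read off the state with no outside help: `total (state A k)` is, by
-- definition, the polynomial `sizePoly (suc k) (dominatesᵇ (suc k) A false)` of Dt-graphOn.
total : State → Poly
total v = weigh (v false)

-- Choices d0, d1, d2 for the front triangle are admissible when vertex 0 is dominated
-- (from outside, by 1 or by 2) and vertex 1 is dominated (by 0 or by 2).
admissible : Bool → Bool → Bool → Bool → Bool
admissible e d0 d1 d2 = (e ∨ d1 ∨ d2) ∧ (d0 ∨ d2)

-- Removing a front triangle: sum over the choices d1, d2 for vertices 1, 2; vertex 2
-- becomes the new vertex 0, dominated from outside iff d0 or d1 is chosen.
transfer : State → State
transfer v e d0 =
  weigh (λ d1 → weigh (λ d2 → when (admissible e d0 d1 d2) (v (d0 ∨ d1) d2)))

transfer-combination : ∀ {a t b c : State} →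
  (∀ e d → Combination (a e d) (t e d) (b e d) (c e d)) →
  ∀ e d → Combination (transfer a e d) (transfer t e d) (transfer b e d) (transfer c e d)
transfer-combination h e d0 = combination-weigh λ d1 → combination-weigh λ d2 →
  combination-when (admissible e d0 d1 d2) (h (d0 ∨ d1) d2)

total-combination : ∀ {a t b c : State} → (∀ e d → Combination (a e d) (t e d) (b e d) (c e d)) →
  Combination (total a) (total t) (total b) (total c)
total-combination h = combination-weigh (h false)

record TriangleFront (A A′ : ℕ → ℕ → Bool) : Set where
  field
    nbrs-0  : ∀ b → A 0 b ≡ ((b ≡ᵇ 1) ∨ (b ≡ᵇ 2))
    nbrs-1  : ∀ b → A 1 b ≡ ((b ≡ᵇ 0) ∨ (b ≡ᵇ 2))
    to-0    : ∀ a → A (suc (suc a)) 0 ≡ (a ≡ᵇ 0)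
    to-1    : ∀ a → A (suc (suc a)) 1 ≡ (a ≡ᵇ 0)
    shifted : ∀ a b → A (suc (suc a)) (suc (suc b)) ≡ A′ a b

vertex-0 : ∀ e d0 d1 d2 → (e ∧ true) ∨ ((d0 ∧ false) ∨ ((d1 ∧ true) ∨ ((d2 ∧ true) ∨ false)))
                          ≡ (e ∨ d1 ∨ d2)
vertex-0 e d0 d1 d2 rewrite ∧-identityʳ e | ∧-zeroʳ d0 | ∧-identityʳ d1 | ∧-identityʳ d2
  | ∨-identityʳ d2 = refl

vertex-1 : ∀ e d0 d1 d2 → (e ∧ false) ∨ ((d0 ∧ true) ∨ ((d1 ∧ false) ∨ ((d2 ∧ true) ∨ false)))
                          ≡ (d0 ∨ d2)
vertex-1 e d0 d1 d2 rewrite ∧-zeroʳ e | ∧-identityʳ d0 | ∧-zeroʳ d1 | ∧-identityʳ d2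
  | ∨-identityʳ d2 = refl

vertex-later : ∀ e d0 d1 z s → (e ∧ false) ∨ ((d0 ∧ z) ∨ ((d1 ∧ z) ∨ s)) ≡ ((d0 ∨ d1) ∧ z) ∨ s
vertex-later e d0 d1 z s rewrite ∧-zeroʳ e with d0 | d1 | z
... | true  | _     | true  = refl
... | true  | true  | false = refl
... | true  | false | false = refl
... | false | _     | _     = refl

front-domination : ∀ {A A′} → TriangleFront A A′ → ∀ k e d0 d1 d2 (D : Vec Bool k) →
  dominatesᵇ (suc (suc (suc k))) A e (d0 ∷ d1 ∷ d2 ∷ D)
    ≡ admissible e d0 d1 d2 ∧ dominatesᵇ (suc k) A′ (d0 ∨ d1) (d2 ∷ D)
front-domination {A} {A′} front k e d0 d1 d2 D =
  begin
    F 0 ∧ (F 1 ∧ every (suc k) (λ v → F (suc (suc v))))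
  ≡⟨ cong₂ (λ x y → x ∧ (y ∧ every (suc k) (λ v → F (suc (suc v))))) F0 F1 ⟩
    (e ∨ d1 ∨ d2) ∧ ((d0 ∨ d2) ∧ every (suc k) (λ v → F (suc (suc v))))
  ≡⟨ sym (∧-assoc (e ∨ d1 ∨ d2) (d0 ∨ d2) _) ⟩
    admissible e d0 d1 d2 ∧ every (suc k) (λ v → F (suc (suc v)))
  ≡⟨ cong (admissible e d0 d1 d2 ∧_) (every-cong (suc k) Flater) ⟩
    admissible e d0 d1 d2 ∧ dominatesᵇ (suc k) A′ (d0 ∨ d1) (d2 ∷ D)
  ∎
  where
  open ≡-Reasoning
  open TriangleFront front
  F : ℕ → Bool
  F v = (e ∧ (v ≡ᵇ 0)) ∨ someIn (d0 ∷ d1 ∷ d2 ∷ D) (A v)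
  F0 : F 0 ≡ (e ∨ d1 ∨ d2)
  F0 rewrite someIn-cong (d0 ∷ d1 ∷ d2 ∷ D) nbrs-0 | someIn-never D = vertex-0 e d0 d1 d2
  F1 : F 1 ≡ (d0 ∨ d2)
  F1 rewrite someIn-cong (d0 ∷ d1 ∷ d2 ∷ D) nbrs-1 | someIn-never D = vertex-1 e d0 d1 d2
  Flater : ∀ v → F (suc (suc v)) ≡ (((d0 ∨ d1) ∧ (v ≡ᵇ 0)) ∨ someIn (d2 ∷ D) (A′ v))
  Flater v rewrite to-0 v | to-1 v | someIn-cong (d2 ∷ D) (shifted v) =
    vertex-later e d0 d1 (v ≡ᵇ 0) _

state-transfer : ∀ {A A′} → TriangleFront A A′ → ∀ k → state A (suc (suc k)) ≈ₛ transfer (state A′ k)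
state-transfer front k e d0 = weigh-cong λ d1 → weigh-cong λ d2 →
  ≈ₚ-trans (sizePoly-cong k (front-domination front k e d0 d1 d2))
           (sizePoly-when k (admissible e d0 d1 d2) _)

laterTriangles : ℕ → ℕ → ℕ → Bool
laterTriangles n a b = anyBelow n (λ k → inTri (suc k) a ∧ inTri (suc k) b)

anyBelow-cong : ∀ n {P Q : ℕ → Bool} → (∀ k → P k ≡ Q k) → anyBelow n P ≡ anyBelow n Q
anyBelow-cong zero    h = refl
anyBelow-cong (suc n) h = cong₂ _∨_ (h n) (anyBelow-cong n h)

anyBelow-never : ∀ n → anyBelow n (λ _ → false) ≡ false
anyBelow-never zero    = refl
anyBelow-never (suc n) = anyBelow-never n

-- `anyBelow` scans from the top; peel off the bottom index instead.
anyBelow-first : ∀ n P → anyBelow (suc n) P ≡ (P 0 ∨ anyBelow n (λ k → P (suc k)))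
anyBelow-first zero    P = refl
anyBelow-first (suc n) P rewrite anyBelow-first n P = ∨-swap (P (suc n)) (P 0) _
  where
  ∨-swap : ∀ x y z → (x ∨ (y ∨ z)) ≡ (y ∨ (x ∨ z))
  ∨-swap true  true  z = refl
  ∨-swap true  false z = refl
  ∨-swap false y     z = refl

adjT-first : ∀ n a b →
  adjTℕ (suc n) a b ≡ (not (a ≡ᵇ b) ∧ ((inTri 0 a ∧ inTri 0 b) ∨ laterTriangles n a b))
adjT-first n a b = cong (not (a ≡ᵇ b) ∧_) (anyBelow-first n _)

inTri-suc : ∀ k a → inTri (suc k) a ≡
  ((a ≡ᵇ suc (suc (2 * k))) ∨ (a ≡ᵇ suc (suc (2 * k)) + 1) ∨ (a ≡ᵇ suc (suc (2 * k)) + 2))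
inTri-suc k a = cong (λ m → (a ≡ᵇ m) ∨ (a ≡ᵇ m + 1) ∨ (a ≡ᵇ m + 2)) (ℕP.*-suc 2 k)

inTri-shift : ∀ k a → inTri (suc k) (suc (suc a)) ≡ inTri k a
inTri-shift k a = inTri-suc k (suc (suc a))

later-avoidsˡ : ∀ n a b → (∀ k → inTri (suc k) a ≡ false) → laterTriangles n a b ≡ false
later-avoidsˡ n a b h =
  trans (anyBelow-cong n (λ k → cong (_∧ inTri (suc k) b) (h k))) (anyBelow-never n)

later-avoidsʳ : ∀ n a b → (∀ k → inTri (suc k) b ≡ false) → laterTriangles n a b ≡ false
later-avoidsʳ n a b h =
  trans (anyBelow-cong n (λ k → trans (cong (inTri (suc k) a ∧_) (h k)) (∧-zeroʳ _))) (anyBelow-never n)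

later-shift : ∀ n a b →
  laterTriangles n (suc (suc a)) (suc (suc b)) ≡ anyBelow n (λ k → inTri k a ∧ inTri k b)
later-shift n a b = anyBelow-cong n (λ k → cong₂ _∧_ (inTri-shift k a) (inTri-shift k b))

frontT : ∀ n → TriangleFront (adjTℕ (suc n)) (adjTℕ n)
frontT n = record
  { nbrs-0  = nbrs-0
  ; nbrs-1  = nbrs-1
  ; to-0    = to-0
  ; to-1    = to-1
  ; shifted = shifted
  }
  where
  nbrs-0 : ∀ b → adjTℕ (suc n) 0 b ≡ ((b ≡ᵇ 1) ∨ (b ≡ᵇ 2))
  nbrs-0 b rewrite adjT-first n 0 b | later-avoidsˡ n 0 b (λ k → inTri-suc k 0) with b
  ... | 0 = refl
  ... | 1 = refl
  ... | 2 = refl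
  ... | suc (suc (suc _)) = refl
  nbrs-1 : ∀ b → adjTℕ (suc n) 1 b ≡ ((b ≡ᵇ 0) ∨ (b ≡ᵇ 2))
  nbrs-1 b rewrite adjT-first n 1 b | later-avoidsˡ n 1 b (λ k → inTri-suc k 1) with b
  ... | 0 = refl
  ... | 1 = refl
  ... | 2 = refl
  ... | suc (suc (suc _)) = refl
  to-0 : ∀ a → adjTℕ (suc n) (suc (suc a)) 0 ≡ (a ≡ᵇ 0)
  to-0 a rewrite adjT-first n (suc (suc a)) 0 | later-avoidsʳ n (suc (suc a)) 0 (λ k → inTri-suc k 0)
    with a
  ... | zero  = refl
  ... | suc _ = refl
  to-1 : ∀ a → adjTℕ (suc n) (suc (suc a)) 1 ≡ (a ≡ᵇ 0)
  to-1 a rewrite adjT-first n (suc (suc a)) 1 | later-avoidsʳ n (suc (suc a)) 1 (λ k → inTri-suc k 1)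
    with a
  ... | zero  = refl
  ... | suc _ = refl
  shifted : ∀ a b → adjTℕ (suc n) (suc (suc a)) (suc (suc b)) ≡ adjTℕ n a b
  shifted a b rewrite adjT-first n (suc (suc a)) (suc (suc b)) | later-shift n a b with a | b
  ... | zero  | zero  = refl
  ... | zero  | suc _ = refl
  ... | suc _ | _     = refl

-- A with one extra edge {u, w}; G_n is T_n with the pendant edge {2n+1, 2n−1}.
withEdge : ℕ → ℕ → (ℕ → ℕ → Bool) → ℕ → ℕ → Bool
withEdge u w A a b = A a b ∨ ((a ≡ᵇ u) ∧ (b ≡ᵇ w)) ∨ ((b ≡ᵇ u) ∧ (a ≡ᵇ w))

withEdge-avoidsˡ : ∀ u w A a b → (a ≡ᵇ u) ≡ false → (a ≡ᵇ w) ≡ false → withEdge u w A a b ≡ A a b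
withEdge-avoidsˡ u w A a b au aw rewrite au | aw | ∧-zeroʳ (b ≡ᵇ u) = ∨-identityʳ (A a b)

withEdge-avoidsʳ : ∀ u w A a b → (b ≡ᵇ u) ≡ false → (b ≡ᵇ w) ≡ false → withEdge u w A a b ≡ A a b
withEdge-avoidsʳ u w A a b bu bw rewrite bu | bw | ∧-zeroʳ (a ≡ᵇ u) = ∨-identityʳ (A a b)

front-withEdge : ∀ {A A′} → TriangleFront A A′ → ∀ u w →
  TriangleFront (withEdge (suc (suc u)) (suc (suc w)) A) (withEdge u w A′)
front-withEdge {A} front u w = record
  { nbrs-0  = λ b → trans (withEdge-avoidsˡ U W A 0 b refl refl) (nbrs-0 b)
  ; nbrs-1  = λ b → trans (withEdge-avoidsˡ U W A 1 b refl refl) (nbrs-1 b)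
  ; to-0    = λ a → trans (withEdge-avoidsʳ U W A (suc (suc a)) 0 refl refl) (to-0 a)
  ; to-1    = λ a → trans (withEdge-avoidsʳ U W A (suc (suc a)) 1 refl refl) (to-1 a)
  ; shifted = λ a b → cong (_∨ _) (shifted a b)
  }
  where
  open TriangleFront front
  U W : ℕ
  U = suc (suc u)
  W = suc (suc w)

-- G_(n+2) has the triangle front G_(n+1); the type spells out adjGℕ as T plus its
-- pendant edge, with 2(n+2) written so that the edge lies beyond the front.
frontG : ∀ n → TriangleFront (withEdge (suc (2 * suc (suc n))) (2 * suc (suc n) ∸ 1) (adjTℕ (suc (suc n))))
                              (withEdge (suc (2 * suc n)) (2 * suc n ∸ 1) (adjTℕ (suc n)))
frontG n = subst₂ (λ x y → TriangleFront (withEdge (suc x) (x ∸ 1) (adjTℕ (suc (suc n))))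
                                           (withEdge (suc y) (y ∸ 1) (adjTℕ (suc n))))
                  (trans (cong (λ m → 2 + m) twice-suc) (sym (ℕP.*-suc 2 (suc n)))) twice-suc
                  (front-withEdge (frontT (suc n)) (suc (suc (suc (2 * n)))) (suc (2 * n)))
  where
  twice-suc : 2 + 2 * n ≡ 2 * suc n
  twice-suc = sym (ℕP.*-suc 2 n)

stateT : ℕ → State
stateT n = state (adjTℕ n) (2 * n)

stateG : ℕ → State
stateG n = state (adjGℕ n) (suc (2 * n))

stepT : ∀ n → stateT (suc n) ≈ₛ transfer (stateT n)
stepT n = subst (λ k → state (adjTℕ (suc n)) k ≈ₛ transfer (stateT n)) (sym (ℕP.*-suc 2 n))
                (state-transfer (frontT n) (2 * n))

-- G_(n+2) loses its front triangle to G_(n+1); G_1 → G_0 is not such a step.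
stepG : ∀ n → stateG (suc (suc n)) ≈ₛ transfer (stateG (suc n))
stepG n = subst (λ k → state (adjGℕ (suc (suc n))) (suc k) ≈ₛ transfer (stateG (suc n)))
                (sym (ℕP.*-suc 2 (suc n)))
                (state-transfer (frontG n) (suc (2 * suc n)))

Dt-T : ∀ n → Dt (T n) ≈ₚ total (stateT n)
Dt-T n = Dt-graphOn (2 * n) (adjTℕ n)

Dt-G : ∀ n → Dt (Gr n) ≈ₚ total (stateG n)
Dt-G n = Dt-graphOn (suc (2 * n)) (adjGℕ n)

agree : ∀ N {p q : Poly} → (∀ (i : Fin N) → p (toℕ i) ≡ q (toℕ i)) →
  (∀ j → p (N + j) ≡ q (N + j)) → p ≈ₚ q
agree zero    low high i       = high i
agree (suc N) low high zero    = low fzero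
agree (suc N) {p} {q} low high (suc i) =
  agree N {λ j → p (suc j)} {λ j → q (suc j)} (low ∘ fsuc) high i

-- For explicit polynomials of degree below 10 the first ten coefficients are compared
-- by evaluation; the tail is supplied (typically by refl, as it is zero on both sides).
byEvaluation : (p q : Poly) → {True (all? λ (i : Fin 10) → p (toℕ i) ℤ.≟ q (toℕ i))} →
  (∀ j → p (10 + j) ≡ q (10 + j)) → p ≈ₚ q
byEvaluation p q {ok} = agree 10 (toWitness ok)

baseStates : ∀ e d → Combination (stateG 3 e d) (stateT 3 e d) (stateG 2 e d) (stateG 1 e d)
baseStates false false = combination (byEvaluation _ _ λ _ → refl)
baseStates false true  = combination (byEvaluation _ _ λ _ → refl)
baseStates true  false = combination (byEvaluation _ _ λ _ → refl)
baseStates true  true  = combination (byEvaluation _ _ λ _ → refl)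

stateRecurrence : ∀ m e d →
  Combination (stateG (3 + m) e d) (stateT (3 + m) e d) (stateG (2 + m) e d) (stateG (1 + m) e d)
stateRecurrence zero    = baseStates
stateRecurrence (suc m) e d =
  combination-resp (stepG (2 + m) e d) (≈ₚ-sym (stepT (3 + m) e d))
                   (≈ₚ-sym (stepG (1 + m) e d)) (≈ₚ-sym (stepG m e d))
                   (transfer-combination (stateRecurrence m) e d)

recurrence : ∀ n → 2 ≤ n → Dt (Gr n) ≈ₚ rhs (Dt (T n)) (Dt (Gr (n ∸ 1))) (Dt (Gr (n ∸ 2)))
recurrence (suc zero) (s≤s ())
recurrence (suc (suc zero))    _ = byEvaluation _ _ λ _ → refl
recurrence (suc (suc (suc m))) _ =
  holds (combination-resp (Dt-G (3 + m)) (≈ₚ-sym (Dt-T (3 + m))) (≈ₚ-sym (Dt-G (2 + m)))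
                          (≈ₚ-sym (Dt-G (1 + m))) (total-combination (stateRecurrence m)))

mainTheorem4 : ((n : ℕ) → 2 ≤ n →
    Dt (Gr n) ≈ₚ [X+1]* (Dt (T n) -ₚ Dt (Gr (n ∸ 1))) +ₚ X²* (Dt (Gr (n ∸ 2))))
    × (Dt (Gr 0) ≈ₚ fromList (+ 0 ∷ + 0 ∷ + 1 ∷ []))
    × (Dt (Gr 1) ≈ₚ fromList (+ 0 ∷ + 0 ∷ + 3 ∷ + 3 ∷ + 1 ∷ []))
    × (Dt (T 2) ≈ₚ fromList (+ 0 ∷ + 0 ∷ + 4 ∷ + 6 ∷ + 5 ∷ + 1 ∷ []))
mainTheorem4 =
  recurrence ,
  byEvaluation _ _ (λ _ → refl) ,
  byEvaluation _ _ (λ _ → refl) ,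
  byEvaluation _ _ (λ _ → refl)
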